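{- For every integer $w\ge1$, $$\#\mathsf W^{\mathrm G}_{\le w}=\sum_{d=1}^{w}\sum_{k=1}^{w}\ \sum_{\substack{x_1+\cdots+x_d=d+k-1\\ x_1,\dots,x_d\ge1}}x_1x_2\cdots x_d.$$
   Context: $\mathsf W^{\mathrm G}_{\le w}$ is the set of pairs $(\mathbf t,\mathbf s)$ of integer tuples $\mathbf t=(t_1,\dots,t_d)$, $\mathbf s=(s_1,\dots,s_d)$ with $1\le d\le w$, $1\le t_1\le s_1$, $0\le t_j\le s_j$ for $2\le j\le d$, and $s_1+\dots+s_d\le w$ (indexing the type G values $\zeta_q^{\mathbf t}[\mathbf s]$ of weight and depth bounded by $w$). -}

module Defs where

open import Data.Nat using (ℕ; zero; suc; _+_; _∸_; _≤_; _≟_)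
open import Data.List using (List; []; _∷_; length; map; concatMap; filter; upTo)
open import Data.Nat.ListAction using (sum; product)
open import Data.List.Relation.Binary.Pointwise using (Pointwise)
open import Data.Product using (Σ; _×_)
open import Relation.Binary.PropositionalEquality using (_≡_)

-- Condition for a pair (t, s) of integer tuples (as lists) to lie in W^G_{≤ w}:
-- d = length ≥ 1 (lists are nonempty), 1 ≤ t₁ ≤ s₁, 0 ≤ tⱼ ≤ sⱼ for j ≥ 2
-- (integers tⱼ ≥ 0 are represented by ℕ), d ≤ w, s₁ + ⋯ + s_d ≤ w.
data IsWG (w : ℕ) : List ℕ → List ℕ → Set where
  isWG : ∀ {t₁ s₁ : ℕ} {ts ss : List ℕ}
       → 1 ≤ t₁ → t₁ ≤ s₁
       → Pointwise _≤_ ts ss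
       → length (t₁ ∷ ts) ≤ w
       → sum (s₁ ∷ ss) ≤ w
       → IsWG w (t₁ ∷ ts) (s₁ ∷ ss)

WG≤ : ℕ → Set
WG≤ w = Σ (List ℕ × List ℕ) λ p → IsWG w (Data.Product.proj₁ p) (Data.Product.proj₂ p)

range1 : ℕ → List ℕ
range1 n = map suc (upTo n)

tuples : ℕ → ℕ → List (List ℕ)
tuples zero    n = [] ∷ []
tuples (suc d) n = concatMap (λ x → map (x ∷_) (tuples d n)) (range1 n)

compSum : ℕ → ℕ → ℕ
compSum d n = sum (map product (filter (λ xs → sum xs ≟ n) (tuples d n)))

rhs : ℕ → ℕ
rhs w = sum (map (λ d → sum (map (λ k → compSum d (d + k ∸ 1)) (range1 w))) (range1 w))

module Submission where

-- For a top row s = (s₁, …, s_d) the admissible bottom rows t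
-- (1 ≤ t₁ ≤ s₁ and 0 ≤ tⱼ ≤ sⱼ for j ≥ 2) are counted by
--   s₁ · (s₂ + 1) ⋯ (s_d + 1) = x₁ ⋯ x_d,   where x = (s₁, s₂ + 1, …, s_d + 1).
-- The map s ↦ x is a bijection between top rows of length d and sum k with
-- s₁ ≥ 1 and compositions of d + k - 1 into d positive parts.  Splitting the
-- top rows by their length d and sum k, both in [1, w], gives the double sum.

open import Defs
open import Data.Nat using (ℕ; _≤_)
open import Data.Fin using (Fin)
open import Function.Bundles using (_↔_)

open import Data.Nat using (zero; suc; _+_; _*_; _∸_; _≟_; pred; z≤n; s≤s)
open import Data.Nat.Properties
  using (≤-irrelevant; ≡-irrelevant; ≤-trans; ≤-reflexive; m≤m+n; m≤n+m; +-cancelˡ-≡; suc-injective; +-commutativeSemigroup)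
open import Data.Nat.ListAction using (sum; product)
open import Algebra.Properties.CommutativeSemigroup +-commutativeSemigroup using (x∙yz≈y∙xz)
open import Data.Fin using (zero; suc; toℕ; fromℕ<)
open import Data.Fin.Properties using (toℕ<n; fromℕ<-toℕ; toℕ-fromℕ<; +↔⊎; *↔×; 0↔⊥)
open import Data.List using (List; []; _∷_; length; map; concat; filter; applyUpTo)
open import Data.List.Properties using (length-map; map-∘; map-id)
open import Data.List.Relation.Unary.Any using (Any)
open import Data.List.Relation.Unary.Any.Properties using (⊥↔Any[]; ∷↔; map↔; concat↔; pure↔)
open import Data.List.Relation.Binary.Pointwise using (Pointwise; []; _∷_; Pointwise-length)
open import Data.Product using (Σ; _×_; _,_; proj₁; proj₂)
open import Data.Product.Function.Dependent.Propositional using (Σ-↔)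
open import Data.Product.Function.NonDependent.Propositional using (_×-↔_)
open import Data.Sum using (_⊎_; inj₁; inj₂)
open import Data.Sum.Function.Propositional using (_⊎-↔_)
open import Data.Unit using (⊤; tt)
open import Data.Empty using (⊥; ⊥-elim)
open import Function.Bundles using (mk↔ₛ′)
open import Function.Properties.Inverse using (↔-refl; ↔-sym; ↔-trans)
open import Function.Related.Propositional using (bijection; module EquationalReasoning)
open import Function.Related.TypeIsomorphisms using (Σ-assoc)
open import Relation.Nullary using (Irrelevant; yes; no; ¬_)
open import Relation.Unary using (Decidable)
open import Relation.Binary.PropositionalEquality using (_≡_; refl; sym; trans; cong; cong₂; subst)

open EquationalReasoning {k = bijection}

Σ-congʳ : {A : Set} {F G : A → Set} → (∀ a → F a ↔ G a) → Σ A F ↔ Σ A G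
Σ-congʳ e = Σ-↔ ↔-refl (λ {a} → e a)

×-irrelevant : {P Q : Set} → Irrelevant P → Irrelevant Q → Irrelevant (P × Q)
×-irrelevant irrP irrQ (p , q) (p′ , q′) = cong₂ _,_ (irrP p p′) (irrQ q q′)

subset-≡ : {A : Set} {P : A → Set} → (∀ {a} → Irrelevant (P a)) →
           ∀ {a b} {p : P a} {q : P b} → a ≡ b → _≡_ {A = Σ A P} (a , p) (b , q)
subset-≡ irr {p = p} {q} refl = cong (_ ,_) (irr p q)

subset↔ : {A B : Set} {P : A → Set} {Q : B → Set} →
  (∀ {a} → Irrelevant (P a)) → (∀ {b} → Irrelevant (Q b)) →
  (f : A → B) (g : B → A) → (∀ {a} → P a → Q (f a)) → (∀ {b} → Q b → P (g b)) →
  (∀ {a} → P a → g (f a) ≡ a) → (∀ {b} → Q b → f (g b) ≡ b) →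
  Σ A P ↔ Σ B Q
subset↔ irrP irrQ f g fP gQ gf fg = mk↔ₛ′
  (λ (a , p) → f a , fP p) (λ (b , q) → g b , gQ q)
  (λ (b , q) → subset-≡ irrQ (fg q)) (λ (a , p) → subset-≡ irrP (gf p))

weighted-subset↔ : {A B : Set} {P : A → Set} {Q : B → Set} (F : B → Set) →
  (∀ {a} → Irrelevant (P a)) → (∀ {b} → Irrelevant (Q b)) →
  (f : A → B) (g : B → A) → (∀ {a} → P a → Q (f a)) → (∀ {b} → Q b → P (g b)) →
  (∀ {a} → P a → g (f a) ≡ a) → (∀ {b} → Q b → f (g b) ≡ b) →
  Σ A (λ a → P a × F (f a)) ↔ Σ B (λ b → Q b × F b)
weighted-subset↔ {A} {B} {P} {Q} F irrP irrQ f g fP gQ gf fg = begin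
  Σ A (λ a → P a × F (f a))           ↔⟨ ↔-sym Σ-assoc ⟩
  Σ (Σ A P) (λ ap → F (f (proj₁ ap))) ↔⟨ Σ-↔ (subset↔ irrP irrQ f g fP gQ gf fg) ↔-refl ⟩
  Σ (Σ B Q) (λ bq → F (proj₁ bq))     ↔⟨ Σ-assoc ⟩
  Σ B (λ b → Q b × F b)               ∎

adjoin↔ : {P A : Set} → Irrelevant P → (A → P) → A ↔ (P × A)
adjoin↔ irr h = mk↔ₛ′ (λ a → h a , a) proj₂ (λ (p , a) → cong (_, a) (irr (h a) p)) (λ _ → refl)

absent↔ : {A B : Set} → ¬ A → B ↔ (A ⊎ B)
absent↔ ¬a = mk↔ₛ′ inj₂ (λ { (inj₁ a) → ⊥-elim (¬a a) ; (inj₂ b) → b })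
  (λ { (inj₁ a) → ⊥-elim (¬a a) ; (inj₂ b) → refl }) (λ _ → refl)

InRange : ℕ → ℕ → Set
InRange n x = 1 ≤ x × x ≤ n

InRange-irrelevant : ∀ {n x} → Irrelevant (InRange n x)
InRange-irrelevant = ×-irrelevant ≤-irrelevant ≤-irrelevant

fibre↔ : {A : Set} {B F : A → Set} (w : ℕ) (f : A → ℕ) → (∀ {a} → B a → 1 ≤ f a) →
  Σ A (λ a → (f a ≤ w × B a) × F a) ↔
  Σ ℕ (λ n → InRange w n × Σ A (λ a → (f a ≡ n × B a) × F a))
fibre↔ w f pos = mk↔ₛ′
  (λ (a , (le , b) , x) → f a , (pos b , le) , a , (refl , b) , x)
  (λ (n , (_ , le) , a , (e , b) , x) → a , (subst (_≤ w) (sym e) le , b) , x)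
  (λ { (n , r , a , (refl , b) , x) → cong (λ r′ → n , r′ , a , (refl , b) , x) (InRange-irrelevant _ _) })
  (λ _ → refl)

Fin↔InRange : ∀ n → Fin n ↔ Σ ℕ (InRange n)
Fin↔InRange n = mk↔ₛ′ (λ i → suc (toℕ i) , s≤s z≤n , toℕ<n i) from to∘from (λ i → fromℕ<-toℕ i (toℕ<n i))
  where
  from : Σ ℕ (InRange n) → Fin n
  from (suc x , _ , x<n) = fromℕ< x<n
  to∘from : ∀ r → (suc (toℕ (from r)) , s≤s z≤n , toℕ<n (from r)) ≡ r
  to∘from (suc x , _ , x<n) = subset-≡ InRange-irrelevant (cong suc (toℕ-fromℕ< x<n))

Fin↔≤ : ∀ s → Fin (suc s) ↔ Σ ℕ (_≤ s)
Fin↔≤ s = ↔-trans (Fin↔InRange (suc s))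
  (subset↔ InRange-irrelevant ≤-irrelevant pred suc lower (λ le → s≤s z≤n , s≤s le) pred-suc (λ _ → refl))
  where
  lower : ∀ {x} → InRange (suc s) x → pred x ≤ s
  lower (s≤s _ , s≤s le) = le
  pred-suc : ∀ {x} → InRange (suc s) x → suc (pred x) ≡ x
  pred-suc (s≤s _ , _) = refl

Fin-sum↔Any : {A : Set} (g : A → ℕ) (xs : List A) → Fin (sum (map g xs)) ↔ Any (λ x → Fin (g x)) xs
Fin-sum↔Any g []       = ↔-trans 0↔⊥ ⊥↔Any[]
Fin-sum↔Any g (x ∷ xs) = begin
  Fin (g x + sum (map g xs))             ↔⟨ +↔⊎ ⟩
  (Fin (g x) ⊎ Fin (sum (map g xs)))     ↔⟨ ↔-refl ⊎-↔ Fin-sum↔Any g xs ⟩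
  (Fin (g x) ⊎ Any (λ y → Fin (g y)) xs) ↔⟨ ∷↔ (λ y → Fin (g y)) ⟩
  Any (λ y → Fin (g y)) (x ∷ xs)         ∎

Σ-Fin-suc : ∀ {n} {P : Fin (suc n) → Set} → (P zero ⊎ Σ (Fin n) (λ i → P (suc i))) ↔ Σ (Fin (suc n)) P
Σ-Fin-suc = mk↔ₛ′
  (λ { (inj₁ p) → zero , p ; (inj₂ (i , p)) → suc i , p })
  (λ { (zero , p) → inj₁ p ; (suc i , p) → inj₂ (i , p) })
  (λ { (zero , p) → refl ; (suc i , p) → refl })
  (λ { (inj₁ p) → refl ; (inj₂ (i , p)) → refl })

Any-applyUpTo : {A : Set} {P : A → Set} (f : ℕ → A) (n : ℕ) →
  Any P (applyUpTo f n) ↔ Σ (Fin n) (λ i → P (f (toℕ i)))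
Any-applyUpTo f zero    = mk↔ₛ′ (λ ()) (λ ()) (λ ()) (λ ())
Any-applyUpTo {P = P} f (suc n) = begin
  Any P (f 0 ∷ applyUpTo (λ i → f (suc i)) n)       ↔⟨ ∷↔ P ⟨
  (P (f 0) ⊎ Any P (applyUpTo (λ i → f (suc i)) n)) ↔⟨ ↔-refl ⊎-↔ Any-applyUpTo (λ i → f (suc i)) n ⟩
  (P (f 0) ⊎ Σ (Fin n) (λ i → P (f (suc (toℕ i))))) ↔⟨ Σ-Fin-suc ⟩
  Σ (Fin (suc n)) (λ i → P (f (toℕ i)))             ∎

Any-range1 : {P : ℕ → Set} (n : ℕ) → Any P (range1 n) ↔ Σ ℕ (λ x → InRange n x × P x)
Any-range1 {P} n = begin
  Any P (range1 n)                              ↔⟨ map↔ ⟨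
  Any (λ x → P (suc x)) (applyUpTo (λ x → x) n) ↔⟨ Any-applyUpTo (λ x → x) n ⟩
  Σ (Fin n) (λ i → P (suc (toℕ i)))             ↔⟨ Σ-↔ (Fin↔InRange n) ↔-refl ⟩
  Σ (Σ ℕ (InRange n)) (λ r → P (proj₁ r))       ↔⟨ Σ-assoc ⟩
  Σ ℕ (λ x → InRange n x × P x)                 ∎

Fin-sum-range1 : (g : ℕ → ℕ) (n : ℕ) → Fin (sum (map g (range1 n))) ↔ Σ ℕ (λ x → InRange n x × Fin (g x))
Fin-sum-range1 g n = ↔-trans (Fin-sum↔Any g (range1 n)) (Any-range1 n)

Any-filter : {A : Set} {P Q : A → Set} (Q? : Decidable Q) → (∀ {x} → Irrelevant (Q x)) →
  (xs : List A) → Any P (filter Q? xs) ↔ Any (λ x → Q x × P x) xs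
Any-filter Q? irr [] = mk↔ₛ′ (λ ()) (λ ()) (λ ()) (λ ())
Any-filter {P = P} {Q} Q? irr (x ∷ xs) with Q? x
... | yes q = begin
  Any P (x ∷ filter Q? xs)                     ↔⟨ ∷↔ P ⟨
  (P x ⊎ Any P (filter Q? xs))                 ↔⟨ adjoin↔ irr (λ _ → q) ⊎-↔ Any-filter Q? irr xs ⟩
  ((Q x × P x) ⊎ Any (λ y → Q y × P y) xs)     ↔⟨ ∷↔ (λ y → Q y × P y) ⟩
  Any (λ y → Q y × P y) (x ∷ xs)               ∎
... | no ¬q = begin
  Any P (filter Q? xs)                         ↔⟨ Any-filter Q? irr xs ⟩
  Any (λ y → Q y × P y) xs                     ↔⟨ absent↔ (λ (q , _) → ¬q q) ⟩
  ((Q x × P x) ⊎ Any (λ y → Q y × P y) xs)     ↔⟨ ∷↔ (λ y → Q y × P y) ⟩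
  Any (λ y → Q y × P y) (x ∷ xs)               ∎

IsTuple : ℕ → ℕ → List ℕ → Set
IsTuple n zero    []       = ⊤
IsTuple n zero    (_ ∷ _)  = ⊥
IsTuple n (suc d) []       = ⊥
IsTuple n (suc d) (x ∷ xs) = InRange n x × IsTuple n d xs

IsTuple-irrelevant : ∀ {n} d xs → Irrelevant (IsTuple n d xs)
IsTuple-irrelevant zero    []       tt tt = refl
IsTuple-irrelevant (suc d) (x ∷ xs) = ×-irrelevant InRange-irrelevant (IsTuple-irrelevant d xs)

Any-tuples : {P : List ℕ → Set} (d n : ℕ) → Any P (tuples d n) ↔ Σ (List ℕ) (λ xs → IsTuple n d xs × P xs)
Any-tuples {P} zero n = begin
  Any P ([] ∷ [])                              ↔⟨ pure↔ ⟨
  P []                                         ↔⟨ empty↔ ⟩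
  Σ (List ℕ) (λ xs → IsTuple n zero xs × P xs) ∎
  where
  empty↔ : P [] ↔ Σ (List ℕ) (λ xs → IsTuple n zero xs × P xs)
  empty↔ = mk↔ₛ′ (λ p → [] , tt , p) (λ { ([] , tt , p) → p })
    (λ { ([] , tt , p) → refl }) (λ _ → refl)
Any-tuples {P} (suc d) n = begin
  Any P (concat (map (λ x → map (x ∷_) (tuples d n)) (range1 n)))
    ↔⟨ concat↔ ⟨
  Any (Any P) (map (λ x → map (x ∷_) (tuples d n)) (range1 n))
    ↔⟨ map↔ ⟨
  Any (λ x → Any P (map (x ∷_) (tuples d n))) (range1 n)
    ↔⟨ Any-range1 n ⟩
  Σ ℕ (λ x → InRange n x × Any P (map (x ∷_) (tuples d n)))
    ↔⟨ Σ-congʳ (λ x → ↔-refl ×-↔ tails↔ x) ⟩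
  Σ ℕ (λ x → InRange n x × Σ (List ℕ) (λ xs → IsTuple n d xs × P (x ∷ xs)))
    ↔⟨ cons↔ ⟩
  Σ (List ℕ) (λ xs → IsTuple n (suc d) xs × P xs)
    ∎
  where
  tails↔ : ∀ x → Any P (map (x ∷_) (tuples d n)) ↔ Σ (List ℕ) (λ xs → IsTuple n d xs × P (x ∷ xs))
  tails↔ x = ↔-trans (↔-sym map↔) (Any-tuples d n)
  cons↔ : Σ ℕ (λ x → InRange n x × Σ (List ℕ) (λ xs → IsTuple n d xs × P (x ∷ xs))) ↔
          Σ (List ℕ) (λ xs → IsTuple n (suc d) xs × P xs)
  cons↔ = mk↔ₛ′ (λ (x , r , xs , t , p) → x ∷ xs , (r , t) , p)
    (λ { (x ∷ xs , (r , t) , p) → x , r , xs , t , p })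
    (λ { (x ∷ xs , (r , t) , p) → refl }) (λ (x , r , xs , t , p) → refl)

Fin-compSum : (d n : ℕ) → Fin (compSum d n) ↔ Σ (List ℕ) (λ xs → (IsTuple n d xs × sum xs ≡ n) × Fin (product xs))
Fin-compSum d n = begin
  Fin (compSum d n)
    ↔⟨ Fin-sum↔Any product _ ⟩
  Any (λ xs → Fin (product xs)) (filter (λ xs → sum xs ≟ n) (tuples d n))
    ↔⟨ Any-filter (λ xs → sum xs ≟ n) ≡-irrelevant _ ⟩
  Any (λ xs → sum xs ≡ n × Fin (product xs)) (tuples d n)
    ↔⟨ Any-tuples d n ⟩
  Σ (List ℕ) (λ xs → IsTuple n d xs × (sum xs ≡ n × Fin (product xs)))
    ↔⟨ Σ-congʳ (λ _ → Σ-assoc) ⟨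
  Σ (List ℕ) (λ xs → (IsTuple n d xs × sum xs ≡ n) × Fin (product xs))
    ∎

DoubleSum : ℕ → (ℕ → ℕ → Set) → Set
DoubleSum w G = Σ ℕ (λ d → InRange w d × Σ ℕ (λ k → InRange w k × G d k))

Compositions : ℕ → ℕ → Set
Compositions d k = Σ (List ℕ) (λ xs → (IsTuple (d + k ∸ 1) d xs × sum xs ≡ d + k ∸ 1) × Fin (product xs))

rhs↔ : ∀ w → Fin (rhs w) ↔ DoubleSum w Compositions
rhs↔ w = ↔-trans (Fin-sum-range1 _ w) (Σ-congʳ λ d → ↔-refl ×-↔
           ↔-trans (Fin-sum-range1 _ w) (Σ-congʳ λ k → ↔-refl ×-↔ Fin-compSum d (d + k ∸ 1)))

Pointwise-count : {A B : Set} {R : A → B → Set} (c : B → ℕ) → (∀ s → Σ A (λ t → R t s) ↔ Fin (c s)) →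
  ∀ ss → Σ (List A) (λ ts → Pointwise R ts ss) ↔ Fin (product (map c ss))
Pointwise-count c count [] = mk↔ₛ′ (λ _ → zero) (λ _ → [] , []) (λ { zero → refl }) (λ { ([] , []) → refl })
Pointwise-count {A} {R = R} c count (s ∷ ss) = begin
  Σ (List A) (λ ts → Pointwise R ts (s ∷ ss))                 ↔⟨ uncons↔ ⟩
  (Σ A (λ t → R t s) × Σ (List A) (λ ts → Pointwise R ts ss)) ↔⟨ count s ×-↔ Pointwise-count c count ss ⟩
  (Fin (c s) × Fin (product (map c ss)))                      ↔⟨ *↔× ⟨
  Fin (c s * product (map c ss))                              ∎
  where
  uncons↔ : Σ (List A) (λ ts → Pointwise R ts (s ∷ ss)) ↔ (Σ A (λ t → R t s) × Σ (List A) (λ ts → Pointwise R ts ss))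
  uncons↔ = mk↔ₛ′ (λ { (t ∷ ts , r ∷ rs) → (t , r) , ts , rs }) (λ ((t , r) , ts , rs) → t ∷ ts , r ∷ rs)
    (λ _ → refl) (λ { (t ∷ ts , r ∷ rs) → refl })

data Below : List ℕ → List ℕ → Set where
  below : ∀ {t₁ s₁ ts ss} → InRange s₁ t₁ → Pointwise _≤_ ts ss → Below (t₁ ∷ ts) (s₁ ∷ ss)

BottomRows : List ℕ → Set
BottomRows s = Σ (List ℕ) (λ t → Below t s)

PositiveHead : List ℕ → Set
PositiveHead []       = ⊥
PositiveHead (s₁ ∷ _) = 1 ≤ s₁

PositiveHead-irrelevant : ∀ s → Irrelevant (PositiveHead s)
PositiveHead-irrelevant (_ ∷ _) = ≤-irrelevant

raiseTail : List ℕ → List ℕ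
raiseTail []        = []
raiseTail (s₁ ∷ ss) = s₁ ∷ map suc ss

lowerTail : List ℕ → List ℕ
lowerTail []        = []
lowerTail (x₁ ∷ xs) = x₁ ∷ map pred xs

BottomRows-count : ∀ s → PositiveHead s → BottomRows s ↔ Fin (product (raiseTail s))
BottomRows-count (s₁ ∷ ss) _ = begin
  BottomRows (s₁ ∷ ss)                                          ↔⟨ uncons↔ ⟩
  (Σ ℕ (InRange s₁) × Σ (List ℕ) (λ ts → Pointwise _≤_ ts ss))  ↔⟨ Fin↔InRange s₁ ×-↔ tails↔ ⟨
  (Fin s₁ × Fin (product (map suc ss)))                         ↔⟨ *↔× ⟨
  Fin (s₁ * product (map suc ss))                               ∎
  where
  uncons↔ : BottomRows (s₁ ∷ ss) ↔ (Σ ℕ (InRange s₁) × Σ (List ℕ) (λ ts → Pointwise _≤_ ts ss))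
  uncons↔ = mk↔ₛ′ (λ { (t₁ ∷ ts , below r pw) → (t₁ , r) , ts , pw }) (λ ((t₁ , r) , ts , pw) → t₁ ∷ ts , below r pw)
    (λ _ → refl) (λ { (t₁ ∷ ts , below r pw) → refl })
  tails↔ : Fin (product (map suc ss)) ↔ Σ (List ℕ) (λ ts → Pointwise _≤_ ts ss)
  tails↔ = ↔-sym (Pointwise-count suc (λ s → ↔-sym (Fin↔≤ s)) ss)

-- Regrouping W^G_{≤w} by the top row s; the depth bound is moved from t to s.
WG≤↔ : ∀ w → WG≤ w ↔ Σ (List ℕ) (λ s → (length s ≤ w × (sum s ≤ w × PositiveHead s)) × BottomRows s)
WG≤↔ w = mk↔ₛ′ to from to∘from from∘to
  where
  Bounds : List ℕ → Set
  Bounds s = length s ≤ w × (sum s ≤ w × PositiveHead s)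
  Bounds-irrelevant : ∀ s → Irrelevant (Bounds s)
  Bounds-irrelevant s = ×-irrelevant ≤-irrelevant (×-irrelevant ≤-irrelevant (PositiveHead-irrelevant s))
  to : WG≤ w → Σ (List ℕ) (λ s → Bounds s × BottomRows s)
  to ((t₁ ∷ ts , s₁ ∷ ss) , isWG a b pw len sm) =
    s₁ ∷ ss , (subst (_≤ w) (cong suc (Pointwise-length pw)) len , sm , ≤-trans a b) , t₁ ∷ ts , below (a , b) pw
  from : Σ (List ℕ) (λ s → Bounds s × BottomRows s) → WG≤ w
  from (s₁ ∷ ss , (len , sm , _) , t₁ ∷ ts , below (a , b) pw) =
    (t₁ ∷ ts , s₁ ∷ ss) , isWG a b pw (subst (_≤ w) (cong suc (sym (Pointwise-length pw))) len) sm
  to∘from : ∀ y → to (from y) ≡ y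
  to∘from (s , bounds , t , below r pw) = cong (λ b → s , b , t , below r pw) (Bounds-irrelevant s _ _)
  from∘to : ∀ x → from (to x) ≡ x
  from∘to ((t₁ ∷ ts , s₁ ∷ ss) , isWG a b pw len sm) = cong (λ l → _ , isWG a b pw l sm) (≤-irrelevant _ _)

TopRows : ℕ → ℕ → Set
TopRows d k = Σ (List ℕ) (λ s → (sum s ≡ k × (length s ≡ d × PositiveHead s)) × BottomRows s)

WG≤↔TopRows : ∀ w → WG≤ w ↔ DoubleSum w TopRows
WG≤↔TopRows w = begin
  WG≤ w
    ↔⟨ WG≤↔ w ⟩
  Σ (List ℕ) (λ s → (length s ≤ w × (sum s ≤ w × PositiveHead s)) × BottomRows s)
    ↔⟨ fibre↔ w length length-pos ⟩
  Σ ℕ (λ d → InRange w d × Σ (List ℕ) (λ s → (length s ≡ d × (sum s ≤ w × PositiveHead s)) × BottomRows s))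
    ↔⟨ Σ-congʳ (λ d → ↔-refl ×-↔ by-weight d) ⟩
  DoubleSum w TopRows
    ∎
  where
  length-pos : ∀ {s} → sum s ≤ w × PositiveHead s → 1 ≤ length s
  length-pos {_ ∷ _} _ = s≤s z≤n
  sum-pos : ∀ {d s} → length s ≡ d × PositiveHead s → 1 ≤ sum s
  sum-pos {s = s₁ ∷ ss} (_ , pos) = ≤-trans pos (m≤m+n s₁ (sum ss))
  swap : {A B C : Set} → (A × (B × C)) ↔ (B × (A × C))
  swap = mk↔ₛ′ (λ (a , b , c) → b , a , c) (λ (b , a , c) → a , b , c) (λ _ → refl) (λ _ → refl)
  by-weight : ∀ d → Σ (List ℕ) (λ s → (length s ≡ d × (sum s ≤ w × PositiveHead s)) × BottomRows s) ↔
                    Σ ℕ (λ k → InRange w k × TopRows d k)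
  by-weight d = ↔-trans (Σ-congʳ λ _ → swap ×-↔ ↔-refl) (fibre↔ w sum sum-pos)

IsTuple-length : ∀ {n} d xs → IsTuple n d xs → length xs ≡ d
IsTuple-length zero    []       _       = refl
IsTuple-length (suc d) (x ∷ xs) (_ , t) = cong suc (IsTuple-length d xs t)

IsTuple-suc-pred : ∀ {n} d xs → IsTuple n d xs → map suc (map pred xs) ≡ xs
IsTuple-suc-pred zero    []           _       = refl
IsTuple-suc-pred (suc d) (suc x ∷ xs) (_ , t) = cong (suc x ∷_) (IsTuple-suc-pred d xs t)

raised-IsTuple : ∀ {n} ys → sum (map suc ys) ≤ n → IsTuple n (length ys) (map suc ys)
raised-IsTuple []       _  = tt
raised-IsTuple (y ∷ ys) le =
  (s≤s z≤n , ≤-trans (m≤m+n (suc y) _) le) , raised-IsTuple ys (≤-trans (m≤n+m _ (suc y)) le)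

sum-map-suc : ∀ xs → sum (map suc xs) ≡ length xs + sum xs
sum-map-suc []       = refl
sum-map-suc (x ∷ xs) = cong suc (trans (cong (x +_) (sum-map-suc xs)) (x∙yz≈y∙xz x (length xs) (sum xs)))

sum-raiseTail : ∀ s₁ ss → sum (raiseTail (s₁ ∷ ss)) ≡ length ss + sum (s₁ ∷ ss)
sum-raiseTail s₁ ss = trans (cong (s₁ +_) (sum-map-suc ss)) (x∙yz≈y∙xz s₁ (length ss) (sum ss))

sum-lowerTail : ∀ {n d} x₁ ys → IsTuple n d ys → d + sum (lowerTail (x₁ ∷ ys)) ≡ sum (x₁ ∷ ys)
sum-lowerTail {d = d} x₁ ys t =
  trans (cong (_+ sum (lowerTail (x₁ ∷ ys))) (sym (trans (length-map pred ys) (IsTuple-length d ys t))))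
  (trans (sym (sum-raiseTail x₁ (map pred ys))) (cong (λ zs → sum (x₁ ∷ zs)) (IsTuple-suc-pred d ys t)))

-- lowerTail undoes raiseTail everywhere; the converse needs positive entries.
lowerTail∘raiseTail : ∀ s → lowerTail (raiseTail s) ≡ s
lowerTail∘raiseTail []        = refl
lowerTail∘raiseTail (s₁ ∷ ss) = cong (s₁ ∷_) (trans (sym (map-∘ ss)) (map-id ss))

TopRows↔Compositions : ∀ d k → 1 ≤ d → TopRows d k ↔ Compositions d k
TopRows↔Compositions (suc d) k _ = ↔-trans
  (Σ-congʳ λ s → Σ-congʳ λ (_ , _ , pos) → BottomRows-count s pos)
  (weighted-subset↔ (λ x → Fin (product x)) irrP irrQ raiseTail lowerTail raise-ok lower-ok
     (λ {s} _ → lowerTail∘raiseTail s) raise∘lower)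
  where
  -- The two subsets matched by the change of variables (m = d + k here).
  P : List ℕ → Set
  P s = sum s ≡ k × (length s ≡ suc d × PositiveHead s)
  Q : List ℕ → Set
  Q x = IsTuple (d + k) (suc d) x × sum x ≡ d + k
  irrP : ∀ {s} → Irrelevant (P s)
  irrP {s} = ×-irrelevant ≡-irrelevant (×-irrelevant ≡-irrelevant (PositiveHead-irrelevant s))
  irrQ : ∀ {x} → Irrelevant (Q x)
  irrQ {x} = ×-irrelevant (IsTuple-irrelevant (suc d) x) ≡-irrelevant
  raise-ok : ∀ {s} → P s → Q (raiseTail s)
  raise-ok {s₁ ∷ ss} (sum≡ , len≡ , pos) = ((pos , head≤) , tail-ok) , total
    where
    total : sum (raiseTail (s₁ ∷ ss)) ≡ d + k
    total = trans (sum-raiseTail s₁ ss) (cong₂ _+_ (suc-injective len≡) sum≡)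
    head≤ : s₁ ≤ d + k
    head≤ = ≤-trans (m≤m+n s₁ _) (≤-reflexive total)
    tail-ok : IsTuple (d + k) d (map suc ss)
    tail-ok = subst (λ e → IsTuple (d + k) e (map suc ss)) (suc-injective len≡)
                (raised-IsTuple ss (≤-trans (m≤n+m _ s₁) (≤-reflexive total)))
  lower-ok : ∀ {x} → Q x → P (lowerTail x)
  lower-ok {x₁ ∷ ys} (((pos , _) , t) , sum≡) =
    +-cancelˡ-≡ d _ _ (trans (sum-lowerTail x₁ ys t) sum≡) ,
    cong suc (trans (length-map pred ys) (IsTuple-length d ys t)) , pos
  raise∘lower : ∀ {x} → Q x → raiseTail (lowerTail x) ≡ x
  raise∘lower {x₁ ∷ ys} ((_ , t) , _) = cong (x₁ ∷_) (IsTuple-suc-pred d ys t)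

-- Proposition 10.8: #W^G_{≤w} = Σ_{d,k ∈ [1,w]} Σ_{x₁+⋯+x_d = d+k-1, xᵢ ≥ 1} x₁⋯x_d.
proposition10p8 : (w : ℕ) → 1 ≤ w → WG≤ w ↔ Fin (rhs w)
proposition10p8 w _ = begin
  WG≤ w                    ↔⟨ WG≤↔TopRows w ⟩
  DoubleSum w TopRows      ↔⟨ (Σ-congʳ λ d → Σ-congʳ λ (1≤d , _) →
                                 Σ-congʳ λ k → ↔-refl ×-↔ TopRows↔Compositions d k 1≤d) ⟩
  DoubleSum w Compositions ↔⟨ rhs↔ w ⟨
  Fin (rhs w)              ∎
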